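{- Let $q$ be a nonzero rational number and $p$ a prime with $q\in\mathbb{Z}_{(p)}^\times$. Then \[D_{p-1}(q)\equiv 2^{I_p(q)}\pmod p.\]
   Context: The Bressoud polynomials $D_n(q)$ are defined by $D_0(q)=1$, $D_1(q)=1+q$ and $D_n(q)=(1+q-q^n+q^{2n-1})D_{n-1}(q)-q(1-q^{n-1})D_{n-2}(q)$ for $n\ge2$. $\mathbb{Z}_{(p)}$ is the localization of $\mathbb{Z}$ at $(p)$. For $q\in\mathbb{Z}_{(p)}^\times$, $\operatorname{ord}_p(q)$ is the multiplicative order of $q\bmod p$ in $(\mathbb{Z}/p\mathbb{Z})^\times$ and $I_p(q)\coloneqq(p-1)/\operatorname{ord}_p(q)$. The congruence is in $\mathbb{Z}_{(p)}$. -}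

module Defs where

open import Data.Nat as ℕ using (ℕ; zero; suc)
open import Data.Nat.DivMod as ℕ using ()
open import Data.Integer as ℤ using (ℤ; +_)
open import Data.Integer.Divisibility as ℤD using ()
open import Data.Rational using (ℚ; _/_; _+_; _*_; _-_; 0ℚ; 1ℚ)
open import Data.Product using (Σ; _×_; ∃; ∃-syntax)
open import Relation.Binary.PropositionalEquality using (_≡_)
open import Relation.Nullary using (¬_)

ι : ℤ → ℚ
ι a = a / 1

_^ᵠ_ : ℚ → ℕ → ℚ
x ^ᵠ zero  = 1ℚ
x ^ᵠ suc n = x * (x ^ᵠ n)

D : ℕ → ℚ → ℚ
D zero q = 1ℚ
D (suc zero) q = 1ℚ + q
D (suc (suc m)) q =
  (1ℚ + q - q ^ᵠ n + q ^ᵠ (2 ℕ.* n ℕ.∸ 1)) * D (suc m) q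
  - q * (1ℚ - q ^ᵠ (n ℕ.∸ 1)) * D m q
  where n = suc (suc m)

InZp : ℕ → ℚ → Set
InZp p x = ∃[ a ] ∃[ b ] ((¬ (+ p ℤD.∣ b)) × (x * ι b ≡ ι a))

UnitZp : ℕ → ℚ → Set
UnitZp p x = ∃[ a ] ∃[ b ] ((¬ (+ p ℤD.∣ a)) × (¬ (+ p ℤD.∣ b)) × (x * ι b ≡ ι a))

CongZp : ℕ → ℚ → ℚ → Set
CongZp p x y = ∃[ z ] (InZp p z × (x - y ≡ ι (+ p) * z))

IsOrd : ℕ → ℚ → ℕ → Set
IsOrd p q k = (1 ℕ.≤ k) × CongZp p (q ^ᵠ k) 1ℚ
              × (∀ j → 1 ℕ.≤ j → j ℕ.< k → ¬ CongZp p (q ^ᵠ j) 1ℚ)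

-- I_p(q) = (p - 1) / ord_p(q), given k = ord_p(q)
Ip : (p k : ℕ) → .{{ℕ.NonZero k}} → ℕ
Ip p k = (p ℕ.∸ 1) ℕ./ k

{-# OPTIONS --safe #-}
module Submission where

-- Both D_n(q) and the Gaussian-binomial sum S_n = Σ_k q^(k²) [n choose k]_q satisfy the
-- recurrence defining D_n: with the companion sum T_n = Σ_k q^(k²+k) [n choose k]_q, the two
-- q-Pascal rules give S_(n+1) = S_n + q^(n+1) T_n and T_(n+1) = q^(n+1) S_(n+1) + (1 - q^(n+1)) T_n.
-- Now reduce modulo p, in the integral domain ℤ_(p)/pℤ_(p) of characteristic p. The Frobenius
-- identity (x + y)^p = x^p + y^p gives Fermat's little theorem, so q^(p-1) = 1 and d = ord_p(q)
-- divides p - 1. Since q has order exactly d, the absorption identity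
-- (1 - q^k) [d choose k]_q = (1 - q^d) [d-1 choose k-1]_q forces [d choose k]_q = 0 for 0 < k < d,
-- hence S_d = T_d = 2. The coefficients of the recurrence are d-periodic in n, so S_(md) = 2^m and
-- D_(p-1)(q) = S_(p-1) ≡ 2^((p-1)/d).

open import Defs
open import Algebra.Bundles using (CommutativeSemiring; CommutativeRing)
open import Data.Empty using (⊥-elim)
open import Data.Fin.Base as Fin using (Fin; toℕ; inject₁; fromℕ)
open import Data.Fin.Properties using (toℕ<n; toℕ≤pred[n]; toℕ-inject₁; toℕ-fromℕ)
open import Data.Integer.Base as ℤ using (ℤ; +_; -[1+_])
import Data.Integer.Divisibility as ℤ
import Data.Integer.Divisibility.Signed as Signed
import Data.Integer.Properties as ℤ
open import Data.Nat.Base as ℕ using (ℕ; zero; suc; _∸_; _≤_; _<_; z≤n; s≤s; _!; NonZero)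
open import Data.Nat.Combinatorics using (_C_; nCk≡n!/k![n-k]!; k![n∸k]!∣n!; nCn≡1)
open import Data.Nat.Coprimality as Coprime using (1-coprimeTo)
open import Data.Nat.Divisibility using (_∣_; divides; ∣1⇒≡1; ∣⇒≤)
open import Data.Nat.DivMod using (_/_; _%_; m/n*n≡m; m≡m%n+[m/n]*n; m%n<n)
open import Data.Nat.Primality using (Prime; euclidsLemma; prime⇒nonTrivial; prime⇒nonZero; ¬prime[0])
import Data.Nat.Properties as ℕ
open import Data.Nat.Tactic.RingSolver using (solve-∀)
open import Data.Product.Base using (_,_; proj₁; proj₂; ∃-syntax)
open import Data.Rational.Base as ℚ using (ℚ; mkℚ; 0ℚ; 1ℚ; ↥_)
import Data.Rational.Properties as ℚ
open import Data.Rational.Solver using (module +-*-Solver)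
open import Data.Sum.Base as Sum using (_⊎_; inj₁; inj₂; [_,_])
open import Function.Base using (id; _∘_)
open import Level using (0ℓ)
open import Relation.Binary.PropositionalEquality as ≡ using (_≡_; _≢_)
open import Relation.Nullary.Negation using (¬_; contradiction)

private
  exponent-pascal′ : ∀ c {n k} → k ≤ n →
    suc k ℕ.* (suc k ℕ.+ c) ℕ.+ (n ∸ k) ≡ (suc n ℕ.+ c) ℕ.+ k ℕ.* (k ℕ.+ suc c)
  exponent-pascal′ c {n} {k} k≤n =
    ≡.trans (lemma c k (n ∸ k)) (≡.cong (λ m → (suc m ℕ.+ c) ℕ.+ k ℕ.* (k ℕ.+ suc c)) (ℕ.m+[n∸m]≡n k≤n))
    where
    lemma : ∀ c k m → suc k ℕ.* (suc k ℕ.+ c) ℕ.+ m ≡ (suc (k ℕ.+ m) ℕ.+ c) ℕ.+ k ℕ.* (k ℕ.+ suc c)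
    lemma = solve-∀

  exponent-pascal : ∀ c k → suc k ℕ.* (suc k ℕ.+ c) ≡ suc c ℕ.+ k ℕ.* (k ℕ.+ suc (suc c))
  exponent-pascal = solve-∀

  exponent-shift : ∀ c k → suc k ℕ.* (suc k ℕ.+ c) ℕ.+ suc k ≡ suc k ℕ.* (suc k ℕ.+ suc c)
  exponent-shift = solve-∀

module GaussianBinomial {c ℓ} (R : CommutativeSemiring c ℓ) (q : CommutativeSemiring.Carrier R) where

  open CommutativeSemiring R
  open import Algebra.Properties.Semiring.Exp semiring using (_^_; ^-congʳ; ^-homo-*)
  open import Algebra.Properties.Semiring.Sum semiring
  open import Algebra.Solver.Ring.NaturalCoefficients.Default R
  open import Relation.Binary.Reasoning.Setoid setoid

  infix 10 [_choose_]
  [_choose_] : ℕ → ℕ → Carrier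
  [ n     choose zero  ] = 1#
  [ zero  choose suc k ] = 0#
  [ suc n choose suc k ] = [ n choose k ] + q ^ suc k * [ n choose suc k ]

  choose-above : ∀ {n k} → n < k → [ n choose k ] ≈ 0#
  choose-above {zero}  {suc k} _         = refl
  choose-above {suc n} {suc k} (s≤s n<k) = begin
    [ n choose k ] + q ^ suc k * [ n choose suc k ]
      ≈⟨ +-cong (choose-above n<k) (*-congˡ (choose-above (ℕ.m<n⇒m<1+n n<k))) ⟩
    0# + q ^ suc k * 0#
      ≈⟨ solve 1 (λ x → con 0 :+ x :* con 0 := con 0) refl (q ^ suc k) ⟩
    0# ∎

  choose-diag : ∀ n → [ n choose n ] ≈ 1#
  choose-diag zero    = refl
  choose-diag (suc n) = begin
    [ n choose n ] + q ^ suc n * [ n choose suc n ]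
      ≈⟨ +-cong (choose-diag n) (*-congˡ (choose-above (ℕ.n<1+n n))) ⟩
    1# + q ^ suc n * 0#
      ≈⟨ solve 1 (λ x → con 1 :+ x :* con 0 := con 1) refl (q ^ suc n) ⟩
    1# ∎

  pascal′ : ∀ {n k} → k ≤ n → [ suc n choose suc k ] ≈ q ^ (n ∸ k) * [ n choose k ] + [ n choose suc k ]
  pascal′ {zero} z≤n = solve 1 (λ x → con 1 :+ (x :* con 1) :* con 0 := con 1 :* con 1 :+ con 0) refl q
  pascal′ {suc n} {zero} z≤n = begin
    1# + q ^ 1 * [ suc n choose 1 ]
      ≈⟨ +-congˡ (*-congˡ (pascal′ {n} z≤n)) ⟩
    1# + q ^ 1 * (q ^ n * 1# + [ n choose 1 ])
      ≈⟨ solve 3 (λ x y z → con 1 :+ (x :* con 1) :* (y :* con 1 :+ z)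
                          := (x :* y) :* con 1 :+ (con 1 :+ (x :* con 1) :* z)) refl q (q ^ n) [ n choose 1 ] ⟩
    q ^ suc n * 1# + [ suc n choose 1 ] ∎
  pascal′ {suc n} {suc k} (s≤s k≤n) with ℕ.m≤n⇒m<n∨m≡n k≤n
  ... | inj₂ ≡.refl = begin
    [ suc (suc n) choose suc (suc n) ]
      ≈⟨ choose-diag (suc (suc n)) ⟩
    1#
      ≈⟨ solve 0 (con 1 := con 1 :* con 1 :+ con 0) refl ⟩
    1# * 1# + 0#
      ≈⟨ +-cong (*-cong (^-congʳ q (ℕ.n∸n≡0 n)) (choose-diag (suc n))) (choose-above (ℕ.n<1+n (suc n))) ⟨
    q ^ (n ∸ n) * [ suc n choose suc n ] + [ suc n choose suc (suc n) ] ∎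
  ... | inj₁ k<n = begin
    [ suc n choose suc k ] + q ^ suc (suc k) * [ suc n choose suc (suc k) ]
      ≈⟨ +-cong (pascal′ k≤n) (*-congˡ (pascal′ k<n)) ⟩
    (q ^ (n ∸ k) * g₀ + g₁) + q ^ suc (suc k) * (q ^ m * g₁ + g₂)
      ≈⟨ +-congʳ (+-congʳ (*-congʳ (^-congʳ q (ℕ.+-∸-assoc 1 k<n)))) ⟩
    (q ^ suc m * g₀ + g₁) + q ^ suc (suc k) * (q ^ m * g₁ + g₂)
      ≈⟨ solve 6 (λ x a b g₀ g₁ g₂ → ((x :* a) :* g₀ :+ g₁) :+ (x :* b) :* (a :* g₁ :+ g₂)
                                  := (x :* a) :* (g₀ :+ b :* g₁) :+ (g₁ :+ (x :* b) :* g₂))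
                 refl q (q ^ m) (q ^ suc k) g₀ g₁ g₂ ⟩
    q ^ suc m * [ suc n choose suc k ] + [ suc n choose suc (suc k) ]
      ≈⟨ +-congʳ (*-congʳ (^-congʳ q (ℕ.+-∸-assoc 1 k<n))) ⟨
    q ^ (n ∸ k) * [ suc n choose suc k ] + [ suc n choose suc (suc k) ] ∎
    where
    m  = n ∸ suc k
    g₀ = [ n choose k ]
    g₁ = [ n choose suc k ]
    g₂ = [ n choose suc (suc k) ]

  -- (1 - q^(k+1)) [n+1 choose k+1] = (1 - q^(n+1)) [n choose k], with both sides moved so that
  -- no subtraction occurs.
  absorption : ∀ {n k} → k ≤ n →
               [ suc n choose suc k ] + q ^ suc n * [ n choose k ] ≈ [ n choose k ] + q ^ suc k * [ suc n choose suc k ]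
  absorption {n} {k} k≤n = begin
    (g₀ + e * g₁) + q ^ suc n * g₀
      ≈⟨ +-congˡ (*-congʳ (^-congʳ q (≡.cong suc (ℕ.m+[n∸m]≡n k≤n)))) ⟨
    (g₀ + e * g₁) + q ^ (suc k ℕ.+ (n ∸ k)) * g₀
      ≈⟨ +-congˡ (*-congʳ (^-homo-* q (suc k) (n ∸ k))) ⟩
    (g₀ + e * g₁) + (e * a) * g₀
      ≈⟨ solve 4 (λ g₀ g₁ e a → (g₀ :+ e :* g₁) :+ (e :* a) :* g₀ := g₀ :+ e :* (a :* g₀ :+ g₁)) refl g₀ g₁ e a ⟩
    g₀ + e * (a * g₀ + g₁)
      ≈⟨ +-congˡ (*-congˡ (pascal′ k≤n)) ⟨
    g₀ + e * [ suc n choose suc k ] ∎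
    where
    e  = q ^ suc k
    a  = q ^ (n ∸ k)
    g₀ = [ n choose k ]
    g₁ = [ n choose suc k ]

  ∑-init-last : ∀ n (f : ℕ → Carrier) → ∑[ k < suc n ] f (toℕ k) ≈ ∑[ k < n ] f (toℕ k) + f n
  ∑-init-last n f = begin
    ∑[ k < suc n ] f (toℕ k)
      ≈⟨ sum-init-last (λ k → f (toℕ k)) ⟩
    ∑[ k < n ] f (toℕ (inject₁ k)) + f (toℕ (fromℕ n))
      ≡⟨ ≡.cong₂ _+_ (sum-cong-≗ {n} (λ k → ≡.cong f (toℕ-inject₁ k))) (≡.cong f (toℕ-fromℕ n)) ⟩
    ∑[ k < n ] f (toℕ k) + f n ∎

  gaussTerm : ℕ → ℕ → ℕ → Carrier
  gaussTerm c n k = q ^ (k ℕ.* (k ℕ.+ c)) * [ n choose k ]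

  gaussSum : ℕ → ℕ → Carrier
  gaussSum c n = ∑[ k < suc n ] gaussTerm c n (toℕ k)

  gaussSum-zero : ∀ c → gaussSum c 0 ≈ 1#
  gaussSum-zero c = solve 0 (con 1 :* con 1 :+ con 0 := con 1) refl

  private
    ∑-gaussTerm-suc : ∀ c n → ∑[ k < suc n ] gaussTerm c n (suc (toℕ k)) ≈ ∑[ k < n ] gaussTerm c n (suc (toℕ k))
    ∑-gaussTerm-suc c n = begin
      ∑[ k < suc n ] f (toℕ k)       ≈⟨ ∑-init-last n f ⟩
      ∑[ k < n ] f (toℕ k) + f n     ≈⟨ +-congˡ (*-congˡ (choose-above (ℕ.n<1+n n))) ⟩
      ∑[ k < n ] f (toℕ k) + x * 0#  ≈⟨ solve 2 (λ s x → s :+ x :* con 0 := s) refl (∑[ k < n ] f (toℕ k)) x ⟩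
      ∑[ k < n ] f (toℕ k)           ∎
      where
      f = λ k → gaussTerm c n (suc k)
      x = q ^ (suc n ℕ.* (suc n ℕ.+ c))

    ^-split : ∀ {a b c d} → a ℕ.+ b ≡ c ℕ.+ d → q ^ a * q ^ b ≈ q ^ c * q ^ d
    ^-split {a} {b} {c} {d} eq = begin
      q ^ a * q ^ b   ≈⟨ ^-homo-* q a b ⟨
      q ^ (a ℕ.+ b)   ≡⟨ ≡.cong (q ^_) eq ⟩
      q ^ (c ℕ.+ d)   ≈⟨ ^-homo-* q c d ⟩
      q ^ c * q ^ d   ∎

    gaussSum-recurrence : ∀ {c c′ c″ n} x →
      (∀ {k} → k ≤ n → gaussTerm c (suc n) (suc k) ≈ x * gaussTerm c′ n k + gaussTerm c″ n (suc k)) →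
      gaussSum c (suc n) ≈ gaussSum c″ n + x * gaussSum c′ n
    gaussSum-recurrence {c} {c′} {c″} {n} x step = begin
      t₀ + ∑[ k < suc n ] gaussTerm c (suc n) (suc (toℕ k))
        ≈⟨ +-congˡ (sum-cong-≋ {suc n} (λ k → step (toℕ≤pred[n] k))) ⟩
      t₀ + ∑[ k < suc n ] (x * u (toℕ k) + v (toℕ k))
        ≈⟨ +-congˡ (∑-distrib-+ {suc n} (λ k → x * u (toℕ k)) (λ k → v (toℕ k))) ⟩
      t₀ + (∑[ k < suc n ] (x * u (toℕ k)) + ∑[ k < suc n ] v (toℕ k))
        ≈⟨ +-congˡ (+-cong (sym (*-distribˡ-sum {suc n} x (λ k → u (toℕ k)))) (∑-gaussTerm-suc c″ n)) ⟩
      t₀ + (x * gaussSum c′ n + ∑[ k < n ] v (toℕ k))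
        ≈⟨ solve 4 (λ t₀ x g s → t₀ :+ (x :* g :+ s) := (t₀ :+ s) :+ x :* g)
             refl t₀ x (gaussSum c′ n) (∑[ k < n ] v (toℕ k)) ⟩
      gaussSum c″ n + x * gaussSum c′ n ∎
      where
      t₀ = 1# * 1#
      u  = gaussTerm c′ n
      v  = λ k → gaussTerm c″ n (suc k)

  gaussSum-suc : ∀ c n → gaussSum c (suc n) ≈ gaussSum c n + q ^ (suc n ℕ.+ c) * gaussSum (suc c) n
  gaussSum-suc c n = gaussSum-recurrence (q ^ (suc n ℕ.+ c)) step
    where
    step : ∀ {k} → k ≤ n →
           gaussTerm c (suc n) (suc k) ≈ q ^ (suc n ℕ.+ c) * gaussTerm (suc c) n k + gaussTerm c n (suc k)
    step {k} k≤n = begin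
      q ^ e * [ suc n choose suc k ]
        ≈⟨ *-congˡ (pascal′ k≤n) ⟩
      q ^ e * (q ^ (n ∸ k) * g₀ + g₁)
        ≈⟨ solve 4 (λ x y g₀ g₁ → x :* (y :* g₀ :+ g₁) := (x :* y) :* g₀ :+ x :* g₁)
             refl (q ^ e) (q ^ (n ∸ k)) g₀ g₁ ⟩
      (q ^ e * q ^ (n ∸ k)) * g₀ + q ^ e * g₁
        ≈⟨ +-congʳ (*-congʳ (^-split {e} {n ∸ k} {suc n ℕ.+ c} (exponent-pascal′ c k≤n))) ⟩
      (q ^ (suc n ℕ.+ c) * q ^ (k ℕ.* (k ℕ.+ suc c))) * g₀ + q ^ e * g₁
        ≈⟨ +-congʳ (*-assoc _ _ g₀) ⟩
      q ^ (suc n ℕ.+ c) * gaussTerm (suc c) n k + gaussTerm c n (suc k) ∎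
      where
      e  = suc k ℕ.* (suc k ℕ.+ c)
      g₀ = [ n choose k ]
      g₁ = [ n choose suc k ]

  gaussSum-suc′ : ∀ c n → gaussSum c (suc n) ≈ gaussSum (suc c) n + q ^ suc c * gaussSum (suc (suc c)) n
  gaussSum-suc′ c n = gaussSum-recurrence (q ^ suc c) step
    where
    step : ∀ {k} → k ≤ n →
           gaussTerm c (suc n) (suc k) ≈ q ^ suc c * gaussTerm (suc (suc c)) n k + gaussTerm (suc c) n (suc k)
    step {k} _ = begin
      q ^ e * (g₀ + q ^ suc k * g₁)
        ≈⟨ solve 4 (λ x y g₀ g₁ → x :* (g₀ :+ y :* g₁) := x :* g₀ :+ (x :* y) :* g₁) refl (q ^ e) (q ^ suc k) g₀ g₁ ⟩
      q ^ e * g₀ + (q ^ e * q ^ suc k) * g₁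
        ≈⟨ +-cong (*-congʳ (^-congʳ q (≡.sym (exponent-pascal c k)))) (*-congʳ (^-homo-* q e (suc k))) ⟨
      q ^ (suc c ℕ.+ f) * g₀ + q ^ (e ℕ.+ suc k) * g₁
        ≈⟨ +-cong (*-congʳ (^-homo-* q (suc c) f)) (*-congʳ (^-congʳ q (exponent-shift c k))) ⟩
      (q ^ suc c * q ^ f) * g₀ + gaussTerm (suc c) n (suc k)
        ≈⟨ +-congʳ (*-assoc _ _ g₀) ⟩
      q ^ suc c * gaussTerm (suc (suc c)) n k + gaussTerm (suc c) n (suc k) ∎
      where
      e  = suc k ℕ.* (suc k ℕ.+ c)
      f  = k ℕ.* (k ℕ.+ suc (suc c))
      g₀ = [ n choose k ]
      g₁ = [ n choose suc k ]

  S T : ℕ → Carrier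
  S = gaussSum 0
  T = gaussSum 1

  S-suc : ∀ n → S (suc n) ≈ S n + q ^ suc n * T n
  S-suc n = trans (gaussSum-suc 0 n) (+-congˡ (*-congʳ (^-congʳ q (ℕ.+-identityʳ (suc n)))))

  -- T (n+1) = q^(n+1) S (n+1) + (1 - q^(n+1)) T n, stated without subtraction.
  T-suc : ∀ n → T (suc n) + q ^ suc n * T n ≈ q ^ suc n * S (suc n) + T n
  T-suc n = begin
    T (suc n) + a * T n
      ≈⟨ +-congʳ (gaussSum-suc 1 n) ⟩
    (T n + q ^ (suc n ℕ.+ 1) * gaussSum 2 n) + a * T n
      ≈⟨ +-congʳ (+-congˡ (*-congʳ (^-homo-* q (suc n) 1))) ⟩
    (T n + (a * q ^ 1) * gaussSum 2 n) + a * T n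
      ≈⟨ solve 4 (λ a t x f → (t :+ (a :* x) :* f) :+ a :* t := a :* (t :+ x :* f) :+ t)
           refl a (T n) (q ^ 1) (gaussSum 2 n) ⟩
    a * (T n + q ^ 1 * gaussSum 2 n) + T n
      ≈⟨ +-congʳ (*-congˡ (gaussSum-suc′ 0 n)) ⟨
    a * S (suc n) + T n ∎
    where a = q ^ suc n

module GaussianBinomialAtRootOfUnity {c ℓ} (R : CommutativeRing c ℓ) (q : CommutativeRing.Carrier R) where

  open CommutativeRing R
  open import Data.Product.Base using (_×_)
  open GaussianBinomial commutativeSemiring q public
  open import Algebra.Properties.Semiring.Exp semiring using (_^_; ^-congʳ; ^-homo-*)
  open import Algebra.Properties.Semiring.Sum semiring using (sum-syntax; sum-cong-≋; sum-replicate-zero)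
  open import Algebra.Properties.Group +-group using (∙-cancelʳ; x∙y⁻¹≈ε⇒x≈y; x≈y⇒x∙y⁻¹≈ε)
  open import Algebra.Properties.Ring ring using ([y-z]x≈yx-zx)
  open import Algebra.Solver.Ring.NaturalCoefficients.Default commutativeSemiring
  open import Relation.Binary.Reasoning.Setoid setoid

  two : Carrier
  two = 1# + 1#

  IsOrder : ℕ → Set ℓ
  IsOrder d = q ^ d ≈ 1# × (∀ j → 1 ℕ.≤ j → j < d → ¬ q ^ j ≈ 1#)

  module _ {d} (q^d≈1 : q ^ d ≈ 1#) where

    ^-periodic : ∀ m r → q ^ (m ℕ.* d ℕ.+ r) ≈ q ^ r
    ^-periodic zero    r = refl
    ^-periodic (suc m) r = begin
      q ^ (d ℕ.+ m ℕ.* d ℕ.+ r)     ≡⟨ ≡.cong (q ^_) (ℕ.+-assoc d (m ℕ.* d) r) ⟩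
      q ^ (d ℕ.+ (m ℕ.* d ℕ.+ r))   ≈⟨ ^-homo-* q d (m ℕ.* d ℕ.+ r) ⟩
      q ^ d * q ^ (m ℕ.* d ℕ.+ r)   ≈⟨ *-cong q^d≈1 (^-periodic m r) ⟩
      1# * q ^ r                    ≈⟨ *-identityˡ (q ^ r) ⟩
      q ^ r                         ∎

    private
      S-T-shift : ∀ {x m} → S (m ℕ.* d) ≈ x ^ m → T (m ℕ.* d) ≈ x ^ m → ∀ r →
                  S (m ℕ.* d ℕ.+ r) ≈ x ^ m * S r × T (m ℕ.* d ℕ.+ r) ≈ x ^ m * T r
      S-T-shift {x} {m} S≈ T≈ zero = base 0 S≈ , base 1 T≈
        where
        base : ∀ c → gaussSum c (m ℕ.* d) ≈ x ^ m → gaussSum c (m ℕ.* d ℕ.+ 0) ≈ x ^ m * gaussSum c 0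
        base c F≈ = begin
          gaussSum c (m ℕ.* d ℕ.+ 0)  ≡⟨ ≡.cong (gaussSum c) (ℕ.+-identityʳ (m ℕ.* d)) ⟩
          gaussSum c (m ℕ.* d)        ≈⟨ F≈ ⟩
          x ^ m                       ≈⟨ *-identityʳ (x ^ m) ⟨
          x ^ m * 1#                  ≈⟨ *-congˡ (gaussSum-zero c) ⟨
          x ^ m * gaussSum c 0        ∎
      S-T-shift {x} {m} S≈ T≈ (suc r) =
        trans (reflexive (≡.cong S N+1≡)) S[N+1] ,
        trans (reflexive (≡.cong T N+1≡)) (∙-cancelʳ (a * (y * T r)) _ _ T[N+1]+)
        where
        N = m ℕ.* d ℕ.+ r
        y = x ^ m
        a = q ^ suc r
        IH = S-T-shift {x} {m} S≈ T≈ r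
        N+1≡ : m ℕ.* d ℕ.+ suc r ≡ suc N
        N+1≡ = ℕ.+-suc (m ℕ.* d) r
        q^N+1≈a : q ^ suc N ≈ a
        q^N+1≈a = trans (^-congʳ q (≡.sym N+1≡)) (^-periodic m (suc r))
        S[N+1] : S (suc N) ≈ y * S (suc r)
        S[N+1] = begin
          S (suc N)                ≈⟨ S-suc N ⟩
          S N + q ^ suc N * T N    ≈⟨ +-cong (proj₁ IH) (*-cong q^N+1≈a (proj₂ IH)) ⟩
          y * S r + a * (y * T r)  ≈⟨ solve 4 (λ y s a t → y :* s :+ a :* (y :* t) := y :* (s :+ a :* t))
                                        refl y (S r) a (T r) ⟩
          y * (S r + a * T r)      ≈⟨ *-congˡ (S-suc r) ⟨
          y * S (suc r)            ∎
        T[N+1]+ : T (suc N) + a * (y * T r) ≈ y * T (suc r) + a * (y * T r)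
        T[N+1]+ = begin
          T (suc N) + a * (y * T r)      ≈⟨ +-congˡ (*-cong q^N+1≈a (proj₂ IH)) ⟨
          T (suc N) + q ^ suc N * T N    ≈⟨ T-suc N ⟩
          q ^ suc N * S (suc N) + T N    ≈⟨ +-cong (*-cong q^N+1≈a S[N+1]) (proj₂ IH) ⟩
          a * (y * S (suc r)) + y * T r
            ≈⟨ solve 4 (λ y s a t → a :* (y :* s) :+ y :* t := y :* (a :* s :+ t)) refl y (S (suc r)) a (T r) ⟩
          y * (a * S (suc r) + T r)      ≈⟨ *-congˡ (T-suc r) ⟨
          y * (T (suc r) + a * T r)
            ≈⟨ solve 4 (λ y t′ a t → y :* (t′ :+ a :* t) := y :* t′ :+ a :* (y :* t)) refl y (T (suc r)) a (T r) ⟩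
          y * T (suc r) + a * (y * T r)  ∎

    S-T-periodic : ∀ {x} → S d ≈ x → T d ≈ x → ∀ m → S (m ℕ.* d) ≈ x ^ m × T (m ℕ.* d) ≈ x ^ m
    S-T-periodic     Sd Td zero    = gaussSum-zero 0 , gaussSum-zero 1
    S-T-periodic {x} Sd Td (suc m) = next 0 (proj₁ shifted) Sd , next 1 (proj₂ shifted) Td
      where
      shifted = S-T-shift {x} {m} (proj₁ (S-T-periodic Sd Td m)) (proj₂ (S-T-periodic Sd Td m)) d
      next : ∀ c → gaussSum c (m ℕ.* d ℕ.+ d) ≈ x ^ m * gaussSum c d → gaussSum c d ≈ x →
             gaussSum c (suc m ℕ.* d) ≈ x ^ suc m
      next c F≈ Fd≈ = begin
        gaussSum c (d ℕ.+ m ℕ.* d)   ≡⟨ ≡.cong (gaussSum c) (ℕ.+-comm d (m ℕ.* d)) ⟩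
        gaussSum c (m ℕ.* d ℕ.+ d)   ≈⟨ F≈ ⟩
        x ^ m * gaussSum c d         ≈⟨ *-congˡ Fd≈ ⟩
        x ^ m * x                    ≈⟨ *-comm (x ^ m) x ⟩
        x ^ suc m                    ∎

  order-divides : ∀ {d n} .{{_ : NonZero d}} → IsOrder d → q ^ n ≈ 1# → n ≡ n / d ℕ.* d
  order-divides {d} {n} (q^d≈1 , minimal) q^n≈1 = remainder-zero (n % d) (m≡m%n+[m/n]*n n d) (m%n<n n d)
    where
    remainder-zero : ∀ r → n ≡ r ℕ.+ n / d ℕ.* d → r < d → n ≡ n / d ℕ.* d
    remainder-zero zero    n≡ _   = n≡
    remainder-zero (suc r) n≡ r<d = contradiction (begin
      q ^ suc r                     ≈⟨ ^-periodic q^d≈1 (n / d) (suc r) ⟨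
      q ^ (n / d ℕ.* d ℕ.+ suc r)   ≡⟨ ≡.cong (q ^_) (≡.trans (ℕ.+-comm (n / d ℕ.* d) (suc r)) (≡.sym n≡)) ⟩
      q ^ n                         ≈⟨ q^n≈1 ⟩
      1#                            ∎) (minimal (suc r) (s≤s z≤n) r<d)

  module _ (noZeroDivisors : ∀ {x y} → x * y ≈ 0# → x ≈ 0# ⊎ y ≈ 0#) where

    choose-vanishes : ∀ {n k} → q ^ suc n ≈ 1# → ¬ q ^ suc k ≈ 1# → k ≤ n → [ suc n choose suc k ] ≈ 0#
    choose-vanishes {n} {k} q^n+1≈1 q^k+1≉1 k≤n =
      [ (λ 1-e≈0 → contradiction (sym (x∙y⁻¹≈ε⇒x≈y 1# e 1-e≈0)) q^k+1≉1) , id ] (noZeroDivisors [1-e]X≈0)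
      where
      e = q ^ suc k
      X = [ suc n choose suc k ]
      g = [ n choose k ]
      X≈eX : X ≈ e * X
      X≈eX = ∙-cancelʳ g X (e * X) (begin
        X + g               ≈⟨ +-congˡ (trans (*-congʳ q^n+1≈1) (*-identityˡ g)) ⟨
        X + q ^ suc n * g   ≈⟨ absorption k≤n ⟩
        g + e * X           ≈⟨ +-comm g (e * X) ⟩
        e * X + g           ∎)
      [1-e]X≈0 : (1# - e) * X ≈ 0#
      [1-e]X≈0 = begin
        (1# - e) * X        ≈⟨ [y-z]x≈yx-zx X 1# e ⟩
        1# * X - e * X      ≈⟨ +-congʳ (*-identityˡ X) ⟩
        X - e * X           ≈⟨ x≈y⇒x∙y⁻¹≈ε X≈eX ⟩
        0#                  ∎

    gaussSum-at-order : ∀ c {n} → IsOrder (suc n) → gaussSum c (suc n) ≈ two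
    gaussSum-at-order c {n} (q^d≈1 , minimal) = begin
      1# * 1# + ∑[ k < suc n ] f (suc (toℕ k))            ≈⟨ +-congˡ (∑-init-last n (λ k → f (suc k))) ⟩
      1# * 1# + (∑[ k < n ] f (suc (toℕ k)) + f (suc n))  ≈⟨ +-congˡ (+-cong middle last) ⟩
      1# * 1# + (0# + 1# * 1#)
        ≈⟨ solve 0 (con 1 :* con 1 :+ (con 0 :+ con 1 :* con 1) := con 1 :+ con 1) refl ⟩
      two                                                 ∎
      where
      f = gaussTerm c (suc n)
      vanishing : ∀ {k} → k < n → f (suc k) ≈ 0#
      vanishing {k} k<n =
        trans (*-congˡ (choose-vanishes q^d≈1 (minimal (suc k) (s≤s z≤n) (s≤s k<n)) (ℕ.<⇒≤ k<n))) (zeroʳ _)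
      middle : ∑[ k < n ] f (suc (toℕ k)) ≈ 0#
      middle = trans (sum-cong-≋ {n} (λ k → vanishing (toℕ<n k))) (sum-replicate-zero n)
      last : f (suc n) ≈ 1# * 1#
      last = *-cong (begin
        q ^ (suc n ℕ.* (suc n ℕ.+ c))
          ≡⟨ ≡.cong (q ^_) (≡.trans (ℕ.*-comm (suc n) (suc n ℕ.+ c)) (≡.sym (ℕ.+-identityʳ _))) ⟩
        q ^ ((suc n ℕ.+ c) ℕ.* suc n ℕ.+ 0)
          ≈⟨ ^-periodic {suc n} q^d≈1 (suc n ℕ.+ c) 0 ⟩
        1# ∎) (choose-diag (suc n))

    S-at-multiple-of-order : ∀ {n} → IsOrder (suc n) → ∀ m → S (m ℕ.* suc n) ≈ two ^ m
    S-at-multiple-of-order order m =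
      proj₁ (S-T-periodic (proj₁ order) (gaussSum-at-order 0 order) (gaussSum-at-order 1 order) m)

prime∤! : ∀ {p m} → Prime p → m < p → ¬ p ∣ m !
prime∤! {p} {zero}  p-prime _     p∣1   = ℕ.nonTrivial⇒≢1 {{prime⇒nonTrivial p-prime}} (∣1⇒≡1 p∣1)
prime∤! {p} {suc m} p-prime m+1<p p∣m! =
  [ (λ p∣m+1 → ℕ.<⇒≱ m+1<p (∣⇒≤ p∣m+1)) , prime∤! p-prime (ℕ.<-trans (ℕ.n<1+n m) m+1<p) ]
    (euclidsLemma (suc m) (m !) p-prime p∣m!)

prime∣choose : ∀ {p k} → Prime p → 0 < k → k < p → p ∣ p C k
prime∣choose {suc p-1} {k} p-prime 0<k k<p =
  [ id , ⊥-elim ∘ p∤k![p∸k]! ] (euclidsLemma (p C k) (k ! ℕ.* (p ∸ k) !) p-prime p∣C*k![p∸k]!)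
  where
  p = suc p-1
  p∤k![p∸k]! : ¬ p ∣ k ! ℕ.* (p ∸ k) !
  p∤k![p∸k]! = [ prime∤! p-prime k<p , prime∤! p-prime (ℕ.∸-monoʳ-< 0<k (ℕ.<⇒≤ k<p)) ]
             ∘ euclidsLemma (k !) ((p ∸ k) !) p-prime
  C*k![p∸k]!≡p! : (p C k) ℕ.* (k ! ℕ.* (p ∸ k) !) ≡ p !
  C*k![p∸k]!≡p! = ≡.trans (≡.cong (ℕ._* (k ! ℕ.* (p ∸ k) !)) (nCk≡n!/k![n-k]! (ℕ.<⇒≤ k<p)))
                          (m/n*n≡m {{k ℕ.!* (p ∸ k) !≢0}} (k![n∸k]!∣n! (ℕ.<⇒≤ k<p)))
  p∣C*k![p∸k]! : p ∣ (p C k) ℕ.* (k ! ℕ.* (p ∸ k) !)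
  p∣C*k![p∸k]! = ≡.subst (p ∣_) (≡.sym C*k![p∸k]!≡p!) (divides ((p-1) !) (ℕ.*-comm p ((p-1) !)))

module Frobenius {c ℓ} (R : CommutativeSemiring c ℓ) where

  open CommutativeSemiring R hiding (zero)
  open import Algebra.Properties.Semiring.Exp semiring using (_^_)
  open import Algebra.Properties.Semiring.Mult semiring using (_×_; ×-congʳ; ×-assoc-*; ×1-homo-*)
  open import Algebra.Properties.Semiring.Sum semiring using (sum-syntax; sum-init-last; sum-cong-≋; sum-replicate-zero)
  open import Algebra.Properties.CommutativeSemiring.Binomial R using (theorem; binomialTerm)
  open import Algebra.Properties.Monoid.Mult *-monoid using (×-idem)
  open import Algebra.Solver.Ring.NaturalCoefficients.Default R
  open import Relation.Binary.Reasoning.Setoid setoid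

  ×-multiple-of-characteristic : ∀ {p n} → p × 1# ≈ 0# → ∀ x → p ∣ n → n × x ≈ 0#
  ×-multiple-of-characteristic {p} {n} char x (divides m n≡m*p) = begin
    n × x                      ≈⟨ ×-congʳ n (*-identityˡ x) ⟨
    n × (1# * x)               ≈⟨ ×-assoc-* n 1# x ⟨
    (n × 1#) * x               ≡⟨ ≡.cong (λ k → (k × 1#) * x) n≡m*p ⟩
    ((m ℕ.* p) × 1#) * x       ≈⟨ *-congʳ (×1-homo-* m p) ⟩
    ((m × 1#) * (p × 1#)) * x  ≈⟨ *-congʳ (*-congˡ char) ⟩
    ((m × 1#) * 0#) * x        ≈⟨ solve 2 (λ a x → (a :* con 0) :* x := con 0) refl (m × 1#) x ⟩
    0#                         ∎

  frobenius : ∀ {p} → Prime p → p × 1# ≈ 0# → ∀ x y → (x + y) ^ p ≈ x ^ p + y ^ p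
  frobenius {suc p-1} p-prime char x y = begin
    (x + y) ^ p
      ≈⟨ theorem p x y ⟩
    t Fin.zero + ∑[ i < p ] t (Fin.suc i)
      ≈⟨ +-congˡ (sum-init-last (λ i → t (Fin.suc i))) ⟩
    t Fin.zero + (∑[ i < p-1 ] t (Fin.suc (inject₁ i)) + t (Fin.suc (fromℕ p-1)))
      ≈⟨ +-cong first (+-cong middle last) ⟩
    y ^ p + (0# + x ^ p)
      ≈⟨ solve 2 (λ x y → y :+ (con 0 :+ x) := x :+ y) refl (x ^ p) (y ^ p) ⟩
    x ^ p + y ^ p ∎
    where
    p = suc p-1
    t = binomialTerm x y p
    first : t Fin.zero ≈ y ^ p
    first = solve 1 (λ y → (con 1 :* y) :+ con 0 := y) refl (y ^ p)
    vanishes : ∀ i → t (Fin.suc (inject₁ i)) ≈ 0#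
    vanishes i = ×-multiple-of-characteristic char _
      (prime∣choose p-prime (s≤s z≤n) (s≤s (≡.subst (ℕ._< p-1) (≡.sym (toℕ-inject₁ i)) (toℕ<n i))))
    middle : ∑[ i < p-1 ] t (Fin.suc (inject₁ i)) ≈ 0#
    middle = trans (sum-cong-≋ {p-1} vanishes) (sum-replicate-zero p-1)
    last : t (Fin.suc (fromℕ p-1)) ≈ x ^ p
    last = begin
      t (Fin.suc (fromℕ p-1))          ≡⟨ ≡.cong (λ k → (p C k) × (x ^ k * y ^ (p ∸ k))) (≡.cong suc (toℕ-fromℕ p-1)) ⟩
      (p C p) × (x ^ p * y ^ (p ∸ p))  ≡⟨ ≡.cong₂ (λ c e → c × (x ^ p * y ^ e)) (nCn≡1 p) (ℕ.n∸n≡0 p) ⟩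
      1 × (x ^ p * 1#)                 ≈⟨ solve 1 (λ x → x :* con 1 :+ con 0 := x) refl (x ^ p) ⟩
      x ^ p                            ∎

  fermat-× : ∀ {p} → Prime p → p × 1# ≈ 0# → ∀ n → (n × 1#) ^ p ≈ n × 1#
  fermat-× {suc p-1} p-prime char zero    = zeroˡ (0# ^ p-1)
  fermat-× {suc p-1} p-prime char (suc n) = begin
    (1# + n × 1#) ^ p       ≈⟨ frobenius p-prime char 1# (n × 1#) ⟩
    1# ^ p + (n × 1#) ^ p   ≈⟨ +-cong (×-idem (*-identityʳ 1#) p) (fermat-× p-prime char n) ⟩
    1# + n × 1#             ∎
    where p = suc p-1

ℚ-commutativeSemiring : CommutativeSemiring 0ℓ 0ℓ
ℚ-commutativeSemiring = CommutativeRing.commutativeSemiring ℚ.+-*-commutativeRing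

module Bressoud where

  open CommutativeSemiring ℚ-commutativeSemiring using (semiring)
  open import Algebra.Properties.Semiring.Exp semiring using (_^_; ^-homo-*)
  open import Data.Rational.Base using (_+_; _*_; _-_)
  open ≡ using (refl; cong; cong₂)
  open ≡.≡-Reasoning
  open +-*-Solver

  ^ᵠ≡^ : ∀ x n → x ^ᵠ n ≡ x ^ n
  ^ᵠ≡^ x zero    = refl
  ^ᵠ≡^ x (suc n) = cong (x *_) (^ᵠ≡^ x n)

  module _ (q : ℚ) where

    open GaussianBinomial ℚ-commutativeSemiring q

    private
      minus-from-sum : ∀ {x y z} → x + y ≡ z → x ≡ z - y
      minus-from-sum {x} {y} eq = ≡.trans (solve 2 (λ x y → x := (x :+ y) :- y) refl x y) (cong (_- y) eq)

    S-recurrence : ∀ m → let a = q ^ suc m in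
      S (suc (suc m)) ≡ (1ℚ + q - q * a + (q * a) * a) * S (suc m) - q * (1ℚ - a) * S m
    S-recurrence m = begin
      S (suc (suc m))
        ≡⟨ S-suc (suc m) ⟩
      s₁ + (q * a) * t₁
        ≡⟨ cong (λ t → s₁ + (q * a) * t) (minus-from-sum (T-suc m)) ⟩
      s₁ + (q * a) * ((a * s₁ + t₀) - a * t₀)
        ≡⟨ solve 4 (λ q a s₁ t₀ → s₁ :+ (q :* a) :* ((a :* s₁ :+ t₀) :- a :* t₀)
                              := (con 1ℚ :+ q :- q :* a :+ (q :* a) :* a) :* s₁ :- q :* (con 1ℚ :- a) :* (s₁ :- a :* t₀))
                   refl q a s₁ t₀ ⟩
      (1ℚ + q - q * a + (q * a) * a) * s₁ - q * (1ℚ - a) * (s₁ - a * t₀)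
        ≡⟨ cong (λ s → (1ℚ + q - q * a + (q * a) * a) * s₁ - q * (1ℚ - a) * s) (minus-from-sum (≡.sym (S-suc m))) ⟨
      (1ℚ + q - q * a + (q * a) * a) * s₁ - q * (1ℚ - a) * S m ∎
      where
      a  = q ^ suc m
      s₁ = S (suc m)
      t₀ = T m
      t₁ = T (suc m)

    D≡S : ∀ n → D n q ≡ S n
    D≡S zero          = ≡.sym (gaussSum-zero 0)
    D≡S (suc zero)    = begin
      1ℚ + q                ≡⟨ solve 1 (λ q → con 1ℚ :+ q := con 1ℚ :+ (q :* con 1ℚ) :* con 1ℚ) refl q ⟩
      1ℚ + q ^ 1 * 1ℚ       ≡⟨ cong₂ (λ s t → s + q ^ 1 * t) (gaussSum-zero 0) (gaussSum-zero 1) ⟨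
      S 0 + q ^ 1 * T 0     ≡⟨ S-suc 0 ⟨
      S 1                   ∎
    D≡S (suc (suc m)) = begin
      D (suc (suc m)) q
        ≡⟨ cong₂ (λ x y → c₁ * x - q * (1ℚ - q ^ᵠ suc m) * y) (D≡S (suc m)) (D≡S m) ⟩
      c₁ * S (suc m) - q * (1ℚ - q ^ᵠ suc m) * S m
        ≡⟨ cong₂ (λ c x → c * S (suc m) - q * (1ℚ - x) * S m) c₁≡ (^ᵠ≡^ q (suc m)) ⟩
      (1ℚ + q - q * a + (q * a) * a) * S (suc m) - q * (1ℚ - a) * S m
        ≡⟨ S-recurrence m ⟨
      S (suc (suc m)) ∎
      where
      n = suc (suc m)
      a = q ^ suc m
      c₁ = 1ℚ + q - q ^ᵠ n + q ^ᵠ (2 ℕ.* n ∸ 1)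
      2n-1≡n+[n-1] : ∀ m → m ℕ.+ suc (suc (m ℕ.+ 0)) ≡ suc (m ℕ.+ suc m)
      2n-1≡n+[n-1] = solve-∀
      c₁≡ : c₁ ≡ 1ℚ + q - q * a + (q * a) * a
      c₁≡ = cong₂ (λ x y → 1ℚ + q - x + y) (^ᵠ≡^ q n) (begin
        q ^ᵠ (2 ℕ.* n ∸ 1)      ≡⟨ cong (λ e → q ^ᵠ suc e) (2n-1≡n+[n-1] m) ⟩
        q ^ᵠ (n ℕ.+ suc m)      ≡⟨ ^ᵠ≡^ q (n ℕ.+ suc m) ⟩
        q ^ (n ℕ.+ suc m)       ≡⟨ ^-homo-* q n (suc m) ⟩
        (q * a) * a             ∎)

open Bressoud using (^ᵠ≡^; D≡S)

ι-mkℚ : ∀ a → ι a ≡ mkℚ a 0 (Coprime.sym (1-coprimeTo ℤ.∣ a ∣))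
ι-mkℚ (+ n)    = ℚ.normalize-coprime (Coprime.sym (1-coprimeTo n))
ι-mkℚ -[1+ n ] = ≡.cong ℚ.-_ (ℚ.normalize-coprime (Coprime.sym (1-coprimeTo (suc n))))

ι-+ : ∀ a b → ι (a ℤ.+ b) ≡ ι a ℚ.+ ι b
ι-+ a b rewrite ι-mkℚ a | ι-mkℚ b = ≡.cong (ℚ._/ 1) (≡.sym (≡.cong₂ ℤ._+_ (ℤ.*-identityʳ a) (ℤ.*-identityʳ b)))

ι-* : ∀ a b → ι (a ℤ.* b) ≡ ι a ℚ.* ι b
ι-* a b rewrite ι-mkℚ a | ι-mkℚ b = ≡.refl

ι-neg : ∀ a → ι (ℤ.- a) ≡ ℚ.- ι a
ι-neg (+ zero)  = ≡.refl
ι-neg (+ suc n) = ≡.trans (ι-mkℚ -[1+ n ]) (≡.cong ℚ.-_ (≡.sym (ι-mkℚ (+ suc n))))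
ι-neg -[1+ n ]  = ≡.trans (ι-mkℚ (+ suc n)) (≡.cong ℚ.-_ (≡.sym (ι-mkℚ -[1+ n ])))

ι-injective : ∀ {a b} → ι a ≡ ι b → a ≡ b
ι-injective {a} {b} eq rewrite ι-mkℚ a | ι-mkℚ b = ≡.cong ↥_ eq

module ResidueRing {p : ℕ} (p-prime : Prime p) where

  open import Data.Product.Base using (_×_)
  open import Data.Rational.Base using (_+_; _*_; _-_; -_; 1/_)
  open ≡ using (refl; cong; cong₂)
  open ≡.≡-Reasoning
  open +-*-Solver

  P : ℚ
  P = ι (+ p)

  p∤1 : ¬ (+ p ℤ.∣ + 1)
  p∤1 p∣1 = ℕ.nonTrivial⇒≢1 {{prime⇒nonTrivial p-prime}} (∣1⇒≡1 p∣1)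

  p∣*⇒ : ∀ {a b} → + p ℤ.∣ a ℤ.* b → + p ℤ.∣ a ⊎ + p ℤ.∣ b
  p∣*⇒ {a} {b} p∣ab = euclidsLemma ℤ.∣ a ∣ ℤ.∣ b ∣ p-prime (≡.subst (p ∣_) (ℤ.abs-* a b) p∣ab)

  p∤* : ∀ {a b} → ¬ (+ p ℤ.∣ a) → ¬ (+ p ℤ.∣ b) → ¬ (+ p ℤ.∣ a ℤ.* b)
  p∤* {a} {b} p∤a p∤b = [ p∤a , p∤b ] ∘ p∣*⇒ {a} {b}

  InZp-ι : ∀ a → InZp p (ι a)
  InZp-ι a = a , + 1 , p∤1 , ℚ.*-identityʳ (ι a)

  InZp-+ : ∀ {x y} → InZp p x → InZp p y → InZp p (x + y)
  InZp-+ {x} {y} (a , b , p∤b , xb≡a) (c , e , p∤e , ye≡c) =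
    a ℤ.* e ℤ.+ c ℤ.* b , b ℤ.* e , p∤* {b} {e} p∤b p∤e , (begin
      (x + y) * ι (b ℤ.* e)              ≡⟨ cong ((x + y) *_) (ι-* b e) ⟩
      (x + y) * (ι b * ι e)
        ≡⟨ solve 4 (λ x y b e → (x :+ y) :* (b :* e) := (x :* b) :* e :+ (y :* e) :* b) refl x y (ι b) (ι e) ⟩
      (x * ι b) * ι e + (y * ι e) * ι b  ≡⟨ cong₂ (λ u v → u * ι e + v * ι b) xb≡a ye≡c ⟩
      ι a * ι e + ι c * ι b              ≡⟨ ≡.trans (ι-+ (a ℤ.* e) (c ℤ.* b)) (cong₂ _+_ (ι-* a e) (ι-* c b)) ⟨
      ι (a ℤ.* e ℤ.+ c ℤ.* b)            ∎)

  InZp-* : ∀ {x y} → InZp p x → InZp p y → InZp p (x * y)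
  InZp-* {x} {y} (a , b , p∤b , xb≡a) (c , e , p∤e , ye≡c) =
    a ℤ.* c , b ℤ.* e , p∤* {b} {e} p∤b p∤e , (begin
      (x * y) * ι (b ℤ.* e)  ≡⟨ cong ((x * y) *_) (ι-* b e) ⟩
      (x * y) * (ι b * ι e)  ≡⟨ solve 4 (λ x y b e → (x :* y) :* (b :* e) := (x :* b) :* (y :* e))
                                  refl x y (ι b) (ι e) ⟩
      (x * ι b) * (y * ι e)  ≡⟨ cong₂ _*_ xb≡a ye≡c ⟩
      ι a * ι c              ≡⟨ ι-* a c ⟨
      ι (a ℤ.* c)            ∎)

  InZp-neg : ∀ {x} → InZp p x → InZp p (- x)
  InZp-neg {x} (a , b , p∤b , xb≡a) = ℤ.- a , b , p∤b , (begin
    (- x) * ι b  ≡⟨ ℚ.neg-distribˡ-* x (ι b) ⟨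
    - (x * ι b)  ≡⟨ cong -_ xb≡a ⟩
    - ι a        ≡⟨ ι-neg a ⟨
    ι (ℤ.- a)    ∎)

  InPZp : ℚ → Set
  InPZp x = ∃[ z ] (InZp p z × x ≡ P * z)

  InPZp-resp : ∀ {x y} → x ≡ y → InPZp x → InPZp y
  InPZp-resp refl = id

  InPZp-+ : ∀ {x y} → InPZp x → InPZp y → InPZp (x + y)
  InPZp-+ (z , z∈ , x≡) (w , w∈ , y≡) =
    z + w , InZp-+ {z} {w} z∈ w∈ , ≡.trans (cong₂ _+_ x≡ y≡) (≡.sym (ℚ.*-distribˡ-+ P z w))

  InPZp-neg : ∀ {x} → InPZp x → InPZp (- x)
  InPZp-neg (z , z∈ , x≡) = - z , InZp-neg {z} z∈ , ≡.trans (cong -_ x≡) (ℚ.neg-distribʳ-* P z)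

  InPZp-* : ∀ {x y} → InZp p x → InPZp y → InPZp (x * y)
  InPZp-* {x} x∈ (z , z∈ , y≡) =
    x * z , InZp-* {x} {z} x∈ z∈ , ≡.trans (cong (x *_) y≡) (solve 3 (λ x P z → x :* (P :* z) := P :* (x :* z)) refl x P z)

  InPZp⇒p∣ : ∀ {x a b} → ¬ (+ p ℤ.∣ b) → x * ι b ≡ ι a → InPZp x → + p ℤ.∣ a
  InPZp⇒p∣ {x} {a} {b} p∤b xb≡a (z , (f , g , p∤g , zg≡f) , x≡Pz) =
    [ id , (λ p∣g → contradiction p∣g p∤g) ]
      (p∣*⇒ {a} {g} (divides ℤ.∣ f ℤ.* b ∣ (≡.trans (cong ℤ.∣_∣ ag≡fbp) (ℤ.abs-* (f ℤ.* b) (+ p)))))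
    where
    ag≡fbp : a ℤ.* g ≡ (f ℤ.* b) ℤ.* + p
    ag≡fbp = ι-injective (begin
      ι (a ℤ.* g)            ≡⟨ ι-* a g ⟩
      ι a * ι g              ≡⟨ cong (_* ι g) xb≡a ⟨
      (x * ι b) * ι g        ≡⟨ cong (λ v → (v * ι b) * ι g) x≡Pz ⟩
      ((P * z) * ι b) * ι g  ≡⟨ solve 4 (λ P z b g → ((P :* z) :* b) :* g := ((z :* g) :* b) :* P)
                                  refl P z (ι b) (ι g) ⟩
      ((z * ι g) * ι b) * P  ≡⟨ cong (λ v → (v * ι b) * P) zg≡f ⟩
      (ι f * ι b) * P        ≡⟨ ≡.trans (ι-* (f ℤ.* b) (+ p)) (cong (_* P) (ι-* f b)) ⟨
      ι ((f ℤ.* b) ℤ.* + p)  ∎)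

  p∣⇒InPZp : ∀ {x a b} → ¬ (+ p ℤ.∣ b) → x * ι b ≡ ι a → + p ℤ.∣ a → InPZp x
  p∣⇒InPZp {x} {a} {b} p∤b xb≡a p∣a with Signed.∣ᵤ⇒∣ {+ p} {a} p∣a
  ... | Signed.divides a′ a≡a′p = x * 1/ P , (a′ , b , p∤b , zb≡a′) , x≡Pz
    where
    instance
      P-nonZero : ℚ.NonZero P
      P-nonZero = ℚ.≢-nonZero (λ P≡0 → ¬prime[0] (≡.subst Prime (ℤ.+-injective (ι-injective P≡0)) p-prime))
    zb≡a′ : (x * 1/ P) * ι b ≡ ι a′
    zb≡a′ = begin
      (x * 1/ P) * ι b   ≡⟨ solve 3 (λ x i b → (x :* i) :* b := (x :* b) :* i) refl x (1/ P) (ι b) ⟩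
      (x * ι b) * 1/ P   ≡⟨ cong (_* 1/ P) (≡.trans xb≡a (≡.trans (cong ι a≡a′p) (ι-* a′ (+ p)))) ⟩
      (ι a′ * P) * 1/ P  ≡⟨ ℚ.*-assoc (ι a′) P (1/ P) ⟩
      ι a′ * (P * 1/ P)  ≡⟨ cong (ι a′ *_) (ℚ.*-inverseʳ P) ⟩
      ι a′ * 1ℚ          ≡⟨ ℚ.*-identityʳ (ι a′) ⟩
      ι a′               ∎
    x≡Pz : x ≡ P * (x * 1/ P)
    x≡Pz = begin
      x                  ≡⟨ ℚ.*-identityʳ x ⟨
      x * 1ℚ             ≡⟨ cong (x *_) (ℚ.*-inverseʳ P) ⟨
      x * (P * 1/ P)     ≡⟨ solve 3 (λ x P i → x :* (P :* i) := P :* (x :* i)) refl x P (1/ P) ⟩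
      P * (x * 1/ P)     ∎

  -- The operations are defined by copatterns and η is switched off, so that the type checker
  -- compares ring expressions syntactically instead of unfolding the rational arithmetic and the
  -- integrality proofs inside them.
  record ℤ₍ₚ₎ : Set where
    no-eta-equality
    constructor mk
    field
      value    : ℚ
      integral : InZp p value

  open ℤ₍ₚ₎ public

  fromℤ : ℤ → ℤ₍ₚ₎
  value    (fromℤ a) = ι a
  integral (fromℤ a) = InZp-ι a

  numerator : ℤ₍ₚ₎ → ℤ
  numerator x = proj₁ (integral x)

  infix  8 -ₚ_
  infixl 7 _*ₚ_
  infixl 6 _+ₚ_
  infix  4 _≈ₚ_

  _+ₚ_ _*ₚ_ : ℤ₍ₚ₎ → ℤ₍ₚ₎ → ℤ₍ₚ₎
  value    (x +ₚ y) = value x + value y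
  integral (x +ₚ y) = InZp-+ {value x} {value y} (integral x) (integral y)
  value    (x *ₚ y) = value x * value y
  integral (x *ₚ y) = InZp-* {value x} {value y} (integral x) (integral y)

  -ₚ_ : ℤ₍ₚ₎ → ℤ₍ₚ₎
  value    (-ₚ x) = - value x
  integral (-ₚ x) = InZp-neg {value x} (integral x)

  -- A record rather than a synonym for CongZp, so that both sides stay inferable.
  record _≈ₚ_ (x y : ℤ₍ₚ₎) : Set where
    constructor mk≈
    field congruence : CongZp p (value x) (value y)

  open _≈ₚ_ public

  ≈ₚ-reflexive : ∀ {x y} → value x ≡ value y → x ≈ₚ y
  ≈ₚ-reflexive {x} {y} eq = mk≈ (0ℚ , InZp-ι (+ 0) , (begin
    value x - value y  ≡⟨ cong (λ v → value x - v) (≡.sym eq) ⟩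
    value x - value x  ≡⟨ solve 2 (λ x P → x :- x := P :* con 0ℚ) refl (value x) P ⟩
    P * 0ℚ             ∎))

  residueRing : CommutativeRing 0ℓ 0ℓ
  residueRing = record
    { Carrier = ℤ₍ₚ₎ ; _≈_ = _≈ₚ_ ; _+_ = _+ₚ_ ; _*_ = _*ₚ_ ; -_ = -ₚ_ ; 0# = fromℤ (+ 0) ; 1# = fromℤ (+ 1)
    ; isCommutativeRing = record
      { isRing = record
        { +-isAbelianGroup = record
          { isGroup = record
            { isMonoid = record
              { isSemigroup = record
                { isMagma = record
                  { isEquivalence = record { refl = ≈ₚ-reflexive refl ; sym = ≈ₚ-sym ; trans = ≈ₚ-trans }
                  ; ∙-cong = +-cong }
                ; assoc = λ x y z → ≈ₚ-reflexive (ℚ.+-assoc (value x) (value y) (value z)) }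
              ; identity = (λ x → ≈ₚ-reflexive (ℚ.+-identityˡ (value x)))
                         , (λ x → ≈ₚ-reflexive (ℚ.+-identityʳ (value x))) }
            ; inverse = (λ x → ≈ₚ-reflexive (ℚ.+-inverseˡ (value x)))
                      , (λ x → ≈ₚ-reflexive (ℚ.+-inverseʳ (value x)))
            ; ⁻¹-cong = neg-cong }
          ; comm = λ x y → ≈ₚ-reflexive (ℚ.+-comm (value x) (value y)) }
        ; *-cong = *-cong
        ; *-assoc = λ x y z → ≈ₚ-reflexive (ℚ.*-assoc (value x) (value y) (value z))
        ; *-identity = (λ x → ≈ₚ-reflexive (ℚ.*-identityˡ (value x)))
                     , (λ x → ≈ₚ-reflexive (ℚ.*-identityʳ (value x)))
        ; distrib = (λ x y z → ≈ₚ-reflexive (ℚ.*-distribˡ-+ (value x) (value y) (value z)))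
                  , (λ x y z → ≈ₚ-reflexive (ℚ.*-distribʳ-+ (value x) (value y) (value z))) }
      ; *-comm = λ x y → ≈ₚ-reflexive (ℚ.*-comm (value x) (value y)) } }
    where
    ≈ₚ-sym : ∀ {x y} → x ≈ₚ y → y ≈ₚ x
    ≈ₚ-sym {x} {y} (mk≈ x≈y) =
      mk≈ (InPZp-resp (solve 2 (λ x y → :- (x :- y) := y :- x) refl (value x) (value y)) (InPZp-neg x≈y))
    ≈ₚ-trans : ∀ {x y z} → x ≈ₚ y → y ≈ₚ z → x ≈ₚ z
    ≈ₚ-trans {x} {y} {z} (mk≈ x≈y) (mk≈ y≈z) =
      mk≈ (InPZp-resp (solve 3 (λ x y z → (x :- y) :+ (y :- z) := x :- z) refl (value x) (value y) (value z))
                      (InPZp-+ x≈y y≈z))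
    +-cong : ∀ {x y u v} → x ≈ₚ y → u ≈ₚ v → x +ₚ u ≈ₚ y +ₚ v
    +-cong {x} {y} {u} {v} (mk≈ x≈y) (mk≈ u≈v) =
      mk≈ (InPZp-resp (solve 4 (λ x y u v → (x :- y) :+ (u :- v) := (x :+ u) :- (y :+ v)) refl
                               (value x) (value y) (value u) (value v))
                      (InPZp-+ x≈y u≈v))
    *-cong : ∀ {x y u v} → x ≈ₚ y → u ≈ₚ v → x *ₚ u ≈ₚ y *ₚ v
    *-cong {x} {y} {u} {v} (mk≈ x≈y) (mk≈ u≈v) =
      mk≈ (InPZp-resp (solve 4 (λ x y u v → u :* (x :- y) :+ y :* (u :- v) := x :* u :- y :* v) refl
                               (value x) (value y) (value u) (value v))
                      (InPZp-+ (InPZp-* {value u} (integral u) x≈y) (InPZp-* {value y} (integral y) u≈v)))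
    neg-cong : ∀ {x y} → x ≈ₚ y → -ₚ x ≈ₚ -ₚ y
    neg-cong {x} {y} (mk≈ x≈y) =
      mk≈ (InPZp-resp (solve 2 (λ x y → :- (x :- y) := (:- x) :- (:- y)) refl (value x) (value y)) (InPZp-neg x≈y))

  p≈0 : fromℤ (+ p) ≈ₚ fromℤ (+ 0)
  p≈0 = mk≈ (1ℚ , InZp-ι (+ 1) , solve 1 (λ P → P :- con 0ℚ := P :* con 1ℚ) refl P)

  private
    x-0≡x : ∀ x → x - 0ℚ ≡ x
    x-0≡x x = solve 1 (λ x → x :- con 0ℚ := x) refl x

  ≈0⇒p∣numerator : ∀ x → x ≈ₚ fromℤ (+ 0) → + p ℤ.∣ numerator x
  ≈0⇒p∣numerator x (mk≈ x∈pℤ₍ₚ₎) = go (integral x)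
    where
    go : (r : InZp p (value x)) → + p ℤ.∣ proj₁ r
    go (a , b , p∤b , xb≡a) = InPZp⇒p∣ {value x} {a} {b} p∤b xb≡a (InPZp-resp (x-0≡x (value x)) x∈pℤ₍ₚ₎)

  p∣numerator⇒≈0 : ∀ x → + p ℤ.∣ numerator x → x ≈ₚ fromℤ (+ 0)
  p∣numerator⇒≈0 x = go (integral x)
    where
    go : (r : InZp p (value x)) → + p ℤ.∣ proj₁ r → x ≈ₚ fromℤ (+ 0)
    go (a , b , p∤b , xb≡a) p∣a = mk≈ (InPZp-resp (≡.sym (x-0≡x (value x))) (p∣⇒InPZp {value x} {a} {b} p∤b xb≡a p∣a))

module ResidueField {p : ℕ} (p-prime : Prime p) where

  open ResidueRing p-prime public using (ℤ₍ₚ₎; mk; value; residueRing; mk≈; congruence; ≈0⇒p∣numerator)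
  open ResidueRing p-prime using (integral; fromℤ; numerator; p∣numerator⇒≈0; p∣*⇒; ≈ₚ-reflexive; p≈0)
  open CommutativeRing residueRing
  open import Algebra.Properties.Semiring.Exp semiring using (_^_; ^-congˡ)
  open import Algebra.Properties.CommutativeSemiring.Exp commutativeSemiring using (^-distrib-*)
  open import Algebra.Properties.Semiring.Mult semiring using (_×_)
  open import Algebra.Properties.Semiring.Sum semiring using (sum)
  open import Algebra.Properties.Group +-group using (inverseʳ-unique; x∙y⁻¹≈ε⇒x≈y; x≈y⇒x∙y⁻¹≈ε)
  open import Algebra.Properties.Ring ring using ([y-z]x≈yx-zx)
  open Frobenius commutativeSemiring using (frobenius; fermat-×)
  open import Relation.Binary.Reasoning.Setoid setoid
  open CommutativeSemiring ℚ-commutativeSemiring using () renaming (semiring to ℚ-semiring)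
  open import Algebra.Properties.Semiring.Exp ℚ-semiring using () renaming (_^_ to _^ℚ_)
  import Algebra.Properties.Semiring.Sum ℚ-semiring as ℚΣ

  noZeroDivisors : ∀ {x y} → x * y ≈ 0# → x ≈ 0# ⊎ y ≈ 0#
  noZeroDivisors {x} {y} xy≈0 = Sum.map (p∣numerator⇒≈0 x) (p∣numerator⇒≈0 y)
    (p∣*⇒ {numerator x} {numerator y} (≈0⇒p∣numerator (x * y) xy≈0))

  *-cancelʳ-nonZero : ∀ {x y z} → ¬ z ≈ 0# → x * z ≈ y * z → x ≈ y
  *-cancelʳ-nonZero {x} {y} {z} z≉0 xz≈yz = [ x∙y⁻¹≈ε⇒x≈y x y , (λ z≈0 → contradiction z≈0 z≉0) ]
    (noZeroDivisors {x - y} {z} (trans ([y-z]x≈yx-zx z x y) (x≈y⇒x∙y⁻¹≈ε xz≈yz)))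

  value-×1 : ∀ n → value (n × 1#) ≡ ι (+ n)
  value-×1 zero    = ≡.refl
  value-×1 (suc n) = ≡.trans (≡.cong (1ℚ ℚ.+_) (value-×1 n)) (≡.sym (ι-+ (+ 1) (+ n)))

  characteristic : p × 1# ≈ 0#
  characteristic = trans (≈ₚ-reflexive (value-×1 p)) p≈0

  ^p-neg : ∀ x → (- x) ^ p ≈ - (x ^ p)
  ^p-neg x = inverseʳ-unique (x ^ p) ((- x) ^ p) (begin
    x ^ p + (- x) ^ p  ≈⟨ frobenius p-prime characteristic x (- x) ⟨
    (x - x) ^ p        ≈⟨ ^-congˡ p (-‿inverseʳ x) ⟩
    0# ^ p             ≡⟨ ≡.cong (0# ^_) (ℕ.suc-pred p {{prime⇒nonZero p-prime}}) ⟨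
    0# * 0# ^ (p ∸ 1)  ≈⟨ zeroˡ _ ⟩
    0#                 ∎)

  fromℤ-fermat : ∀ a → fromℤ a ^ p ≈ fromℤ a
  fromℤ-fermat (+ n) = begin
    fromℤ (+ n) ^ p  ≈⟨ ^-congˡ p n×1≈n ⟨
    (n × 1#) ^ p     ≈⟨ fermat-× p-prime characteristic n ⟩
    n × 1#           ≈⟨ n×1≈n ⟩
    fromℤ (+ n)      ∎
    where n×1≈n = ≈ₚ-reflexive (value-×1 n)
  fromℤ-fermat -[1+ n ] = begin
    fromℤ -[1+ n ] ^ p       ≈⟨ ^-congˡ p neg ⟩
    (- fromℤ (+ suc n)) ^ p  ≈⟨ ^p-neg (fromℤ (+ suc n)) ⟩
    - (fromℤ (+ suc n) ^ p)  ≈⟨ -‿cong (fromℤ-fermat (+ suc n)) ⟩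
    - fromℤ (+ suc n)        ≈⟨ neg ⟨
    fromℤ -[1+ n ]           ∎
    where neg = ≈ₚ-reflexive (ι-neg (+ suc n))

  fermat : ∀ x → x ^ p ≈ x
  fermat x = go (integral x)
    where
    go : InZp p (value x) → x ^ p ≈ x
    go (a , b , p∤b , xb≡a) = *-cancelʳ-nonZero B≉0 (begin
      x ^ p * B      ≈⟨ *-congˡ (fromℤ-fermat b) ⟨
      x ^ p * B ^ p  ≈⟨ ^-distrib-* x B p ⟨
      (x * B) ^ p    ≈⟨ ^-congˡ p xB≈A ⟩
      A ^ p          ≈⟨ fromℤ-fermat a ⟩
      A              ≈⟨ xB≈A ⟨
      x * B          ∎)
      where
      A = fromℤ a
      B = fromℤ b
      xB≈A : x * B ≈ A
      xB≈A = ≈ₚ-reflexive xb≡a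
      B≉0 : ¬ B ≈ 0#
      B≉0 B≈0 = p∤b (≈0⇒p∣numerator B B≈0)

  fermat-unit : ∀ {x} → ¬ x ≈ 0# → x ^ (p ∸ 1) ≈ 1#
  fermat-unit {x} x≉0 = *-cancelʳ-nonZero x≉0 (begin
    x ^ (p ∸ 1) * x  ≈⟨ *-comm _ x ⟩
    x ^ suc (p ∸ 1)  ≡⟨ ≡.cong (x ^_) (ℕ.suc-pred p {{prime⇒nonZero p-prime}}) ⟩
    x ^ p            ≈⟨ fermat x ⟩
    x                ≈⟨ *-identityˡ x ⟨
    1# * x           ∎)

  value-^ : ∀ x n → value (x ^ n) ≡ value x ^ᵠ n
  value-^ x zero    = ≡.refl
  value-^ x (suc n) = ≡.cong (value x ℚ.*_) (value-^ x n)

  value-sum : ∀ n (f : Fin n → ℤ₍ₚ₎) → value (sum f) ≡ ℚΣ.sum (λ i → value (f i))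
  value-sum zero    f = ≡.refl
  value-sum (suc n) f = ≡.cong (value (f Fin.zero) ℚ.+_) (value-sum n (λ i → f (Fin.suc i)))

  module _ (q : ℤ₍ₚ₎) where

    private
      module Gₚ = GaussianBinomial commutativeSemiring q
      module Gℚ = GaussianBinomial ℚ-commutativeSemiring (value q)

      value-^ℚ : ∀ n → value (q ^ n) ≡ value q ^ℚ n
      value-^ℚ n = ≡.trans (value-^ q n) (^ᵠ≡^ (value q) n)

    value-choose : ∀ n k → value Gₚ.[ n choose k ] ≡ Gℚ.[ n choose k ]
    value-choose n       zero    = ≡.refl
    value-choose zero    (suc k) = ≡.refl
    value-choose (suc n) (suc k) =
      ≡.cong₂ ℚ._+_ (value-choose n k) (≡.cong₂ ℚ._*_ (value-^ℚ (suc k)) (value-choose n (suc k)))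

    value-gaussSum : ∀ c n → value (Gₚ.gaussSum c n) ≡ Gℚ.gaussSum c n
    value-gaussSum c n = ≡.trans (value-sum (suc n) (λ k → Gₚ.gaussTerm c n (toℕ k)))
      (ℚΣ.sum-cong-≗ {suc n} (λ k → ≡.cong₂ ℚ._*_ (value-^ℚ (toℕ k ℕ.* (toℕ k ℕ.+ c))) (value-choose n (toℕ k))))

proposition3p4 : (q : ℚ) (p : ℕ) → Prime p → q ≢ 0ℚ → UnitZp p q →
    (k : ℕ) .{{_ : NonZero k}} → IsOrd p q k →
    CongZp p (D (p ∸ 1) q) (ι (+ 2) ^ᵠ Ip p k)
proposition3p4 q p p-prime _ (a , b , p∤a , p∤b , qb≡a) d@(suc _) (_ , q^d≡1 , minimal) =
  ≡.subst₂ (CongZp p) value-S value-two^I (congruence S≈two^I)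
  where
  open ResidueField p-prime
  open CommutativeRing residueRing using (_≈_; trans; reflexive; semiring)
  open import Algebra.Properties.Semiring.Exp semiring using (_^_)
  q̂ : ℤ₍ₚ₎
  q̂ = mk q (a , b , p∤b , qb≡a)
  open GaussianBinomialAtRootOfUnity residueRing q̂
  order : IsOrder d
  order = mk≈ (≡.subst (λ v → CongZp p v 1ℚ) (≡.sym (value-^ q̂ d)) q^d≡1)
        , λ j 1≤j j<d q^j≈1 → minimal j 1≤j j<d (≡.subst (λ v → CongZp p v 1ℚ) (value-^ q̂ j) (congruence q^j≈1))
  p-1≡I*d : p ∸ 1 ≡ Ip p d ℕ.* d
  p-1≡I*d = order-divides order (fermat-unit (λ q̂≈0 → p∤a (≈0⇒p∣numerator q̂ q̂≈0)))
  S≈two^I : S (p ∸ 1) ≈ two ^ Ip p d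
  S≈two^I = trans (reflexive (≡.cong S p-1≡I*d)) (S-at-multiple-of-order noZeroDivisors order (Ip p d))
  value-S : value (S (p ∸ 1)) ≡ D (p ∸ 1) q
  value-S = ≡.trans (value-gaussSum q̂ 0 (p ∸ 1)) (≡.sym (D≡S q (p ∸ 1)))
  value-two^I : value (two ^ Ip p d) ≡ ι (+ 2) ^ᵠ Ip p d
  value-two^I = value-^ two (Ip p d)
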